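{- Let $F$ be a tame graph. Let $F'$ be obtained from $F$ by either (a) adding a pendant edge to $F$ (creating a single new leaf vertex) or (b) joining two (not necessarily distinct) vertices of $F$ by a $3$-edge path whose two intermediate vertices are new (if the two vertices of $F$ are the same, then the path is a triangle). Then $F'$ is tame.
   Context: A graph $F$ is tame if there exists a constant $C=C(F)$ such that $\hom(F,G)\le C n^{|V(F)|-|E(F)|/2}$ for every $n$-vertex $C_4$-free graph $G$ with maximum degree at most $2\sqrt{n}$, where $\hom(F,G)$ is the number of graph homomorphisms from $F$ to $G$. -}

module Defs where

open import Data.Nat using (ℕ; zero; suc; _+_; _*_; _^_; _≤_; _<_; _<?_)
open import Data.Bool using (Bool; true; false; not; _∨_; _∧_; if_then_else_)
open import Data.Fin using (Fin; zero; suc; toℕ; _≟_)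
open import Data.List using (List; []; _∷_; map; concatMap; allFin; length; filterᵇ)
open import Data.Nat.ListAction using (sum)
open import Data.Bool.ListAction using (all)
open import Data.Product using (∃; ∃-syntax; Σ; _×_; _,_)
open import Relation.Binary.PropositionalEquality using (_≡_; refl; sym)
open import Relation.Nullary using (¬_; does)

record Graph : Set where
  field
    size   : ℕ
    adj    : Fin size → Fin size → Bool
    adj-sym    : ∀ i j → adj i j ≡ adj j i
    adj-irrefl : ∀ i → adj i i ≡ false
open Graph public

ind : Bool → ℕ
ind true  = 1
ind false = 0

count : ∀ {k} → (Fin k → Bool) → ℕ
count {k} p = sum (map (λ i → ind (p i)) (allFin k))

edges : Graph → ℕ
edges F = sum (map (λ i → count (λ j → does (toℕ i <? toℕ j) ∧ adj F i j)) (allFin (size F)))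

deg : (G : Graph) → Fin (size G) → ℕ
deg G v = count (λ w → adj G v w)

cons : ∀ {k n} → Fin n → (Fin k → Fin n) → Fin (suc k) → Fin n
cons a f zero    = a
cons a f (suc i) = f i

allMaps : (k n : ℕ) → List (Fin k → Fin n)
allMaps zero    n = (λ ()) ∷ []
allMaps (suc k) n = concatMap (λ f → map (λ a → cons a f) (allFin n)) (allMaps k n)

isHom : (F G : Graph) → (Fin (size F) → Fin (size G)) → Bool
isHom F G f = all (λ i → all (λ j → not (adj F i j) ∨ adj G (f i) (f j)) (allFin (size F))) (allFin (size F))

hom : Graph → Graph → ℕ
hom F G = length (filterᵇ (isHom F G) (allMaps (size F) (size G)))

C4Free : Graph → Set
C4Free G = ¬ (Σ (Fin (size G)) λ a → Σ (Fin (size G)) λ b → Σ (Fin (size G)) λ c → Σ (Fin (size G)) λ d →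
             (¬ a ≡ b) × (¬ a ≡ c) × (¬ a ≡ d) × (¬ b ≡ c) × (¬ b ≡ d) × (¬ c ≡ d) ×
             (adj G a b ≡ true) × (adj G b c ≡ true) × (adj G c d ≡ true) × (adj G d a ≡ true))

-- maximum degree at most 2√n, where n = |V(G)|  (equivalently deg² ≤ 4n)
MaxDeg≤2√n : Graph → Set
MaxDeg≤2√n G = ∀ v → deg G v * deg G v ≤ 4 * size G

-- F is tame: ∃ C, hom(F,G) ≤ C n^{|V(F)| - |E(F)|/2} for all n-vertex C4-free G with Δ(G) ≤ 2√n.
-- Stated without reals by squaring and clearing the (possibly negative) exponent:
--   hom(F,G)² · n^{|E(F)|} ≤ C² · n^{2|V(F)|}.
-- (A real constant exists iff a natural one does.)
Tame : Graph → Set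
Tame F = ∃[ C ] ∀ (G : Graph) → C4Free G → MaxDeg≤2√n G →
           hom F G * hom F G * size G ^ edges F ≤ C * C * size G ^ (2 * size F)

_==_ : ∀ {k} → Fin k → Fin k → Bool
i == j = does (i ≟ j)

==-sym : ∀ {k} (i j : Fin k) → (i == j) ≡ (j == i)
==-sym i j with i ≟ j | j ≟ i
... | Relation.Nullary.yes _ | Relation.Nullary.yes _ = refl
... | Relation.Nullary.no _  | Relation.Nullary.no _  = refl
... | Relation.Nullary.yes p | Relation.Nullary.no q  = Data.Empty.⊥-elim (q (sym p))
  where import Data.Empty
... | Relation.Nullary.no q  | Relation.Nullary.yes p = Data.Empty.⊥-elim (q (sym p))
  where import Data.Empty

pendAdj : (F : Graph) → Fin (size F) → Fin (suc (size F)) → Fin (suc (size F)) → Bool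
pendAdj F u zero    zero    = false
pendAdj F u zero    (suc j) = j == u
pendAdj F u (suc i) zero    = i == u
pendAdj F u (suc i) (suc j) = adj F i j

addPendant : (F : Graph) → Fin (size F) → Graph
addPendant F u = record
  { size = suc (size F)
  ; adj = pendAdj F u
  ; adj-sym = s
  ; adj-irrefl = r }
  where
    s : ∀ i j → pendAdj F u i j ≡ pendAdj F u j i
    s zero zero = refl
    s zero (suc j) = refl
    s (suc i) zero = refl
    s (suc i) (suc j) = adj-sym F i j
    r : ∀ i → pendAdj F u i i ≡ false
    r zero = refl
    r (suc i) = adj-irrefl F i

-- (b) join u and w (possibly u = w) by a path u - x - y - w with new vertices
--     x = zero and y = suc zero (a triangle u x y when u = w)
pathAdj : (F : Graph) → Fin (size F) → Fin (size F) →
          Fin (suc (suc (size F))) → Fin (suc (suc (size F))) → Bool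
pathAdj F u w zero          zero          = false
pathAdj F u w zero          (suc zero)    = true
pathAdj F u w (suc zero)    zero          = true
pathAdj F u w (suc zero)    (suc zero)    = false
pathAdj F u w zero          (suc (suc j)) = j == u
pathAdj F u w (suc (suc i)) zero          = i == u
pathAdj F u w (suc zero)    (suc (suc j)) = j == w
pathAdj F u w (suc (suc i)) (suc zero)    = i == w
pathAdj F u w (suc (suc i)) (suc (suc j)) = adj F i j

addPath3 : (F : Graph) → Fin (size F) → Fin (size F) → Graph
addPath3 F u w = record
  { size = suc (suc (size F))
  ; adj = pathAdj F u w
  ; adj-sym = s
  ; adj-irrefl = r }
  where
    s : ∀ i j → pathAdj F u w i j ≡ pathAdj F u w j i
    s zero zero = refl
    s zero (suc zero) = refl
    s (suc zero) zero = refl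
    s (suc zero) (suc zero) = refl
    s zero (suc (suc j)) = refl
    s (suc (suc i)) zero = refl
    s (suc zero) (suc (suc j)) = refl
    s (suc (suc i)) (suc zero) = refl
    s (suc (suc i)) (suc (suc j)) = adj-sym F i j
    r : ∀ i → pathAdj F u w i i ≡ false
    r zero = refl
    r (suc zero) = refl
    r (suc (suc i)) = adj-irrefl F i

-- A homomorphism of F' restricts to one of F, so hom(F', G) is at most hom(F, G) times the
-- largest number of extensions of a homomorphism f of F.  A pendant leaf at u has at most
-- deg (f u) ≤ Δ extensions.  A 3-edge path u - x - y - w is extended by choosing y
-- adjacent to f w and then x adjacent to both f u and y: if y = f u there are at most Δ
-- choices of x, and otherwise x is a common neighbour of two distinct vertices, unique in a
-- C4-free graph, so there are at most 2Δ extensions.  In both cases the exponent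
-- |V| - |E|/2 grows by exactly 1/2, which is paid for by Δ ≤ 2√n.
module Submission where

open import Defs
open import Data.Fin using (Fin; zero; suc; toℕ; _≟_)
open import Data.Product using (_×_; ∃-syntax; _,_)

open import Data.Bool using (Bool; true; false; not; _∨_; _∧_)
open import Data.Bool.ListAction using (all)
open import Data.Bool.Properties using (T-≡; ∧-conicalˡ; ∧-conicalʳ)
open import Data.Fin.Properties using (suc-injective)
open import Data.List using (List; []; _∷_; _++_; map; concatMap; allFin; length; filterᵇ)
open import Data.List.Properties using (map-cong; map-∘; map-++; map-tabulate)
open import Data.List.Membership.Propositional.Properties using (∈-allFin)
open import Data.List.Relation.Unary.All as All using ()
open import Data.List.Relation.Unary.All.Properties using (all⁺; all⁻)
open import Data.Nat using (ℕ; zero; suc; _+_; _*_; _^_; _≤_; _<?_; z≤n)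
open import Data.Nat.ListAction using (sum)
open import Data.Nat.ListAction.Properties using (sum-++)
open import Data.Nat.Properties
  using (≤-refl; ≤-trans; ≤-reflexive; ≤-total; +-mono-≤; *-mono-≤; *-monoˡ-≤; *-monoʳ-≤;
         +-identityʳ; *-identityˡ; *-distribʳ-+; ^-distribˡ-+-*; m≤m+n; module ≤-Reasoning)
open import Data.Nat.Tactic.RingSolver using (solve-∀)
open import Data.Sum using (inj₁; inj₂)
open import Function using (id; _∘_; _⇔_; mk⇔; Equivalence)
open import Relation.Binary.PropositionalEquality
open import Relation.Nullary using (¬_; does; yes; no)
open import Relation.Nullary.Decidable using (dec-true; decidable-stable)

private
  variable
    A B : Set
    k : ℕ

∑ : List A → (A → ℕ) → ℕ
∑ xs f = sum (map f xs)

syntax ∑ xs (λ x → e) = ∑[ x ← xs ] e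

∑-cong : (xs : List A) {f g : A → ℕ} → (∀ x → f x ≡ g x) → ∑ xs f ≡ ∑ xs g
∑-cong xs f≗g = cong sum (map-cong f≗g xs)

∑-mono-≤ : (xs : List A) {f g : A → ℕ} → (∀ x → f x ≤ g x) → ∑ xs f ≤ ∑ xs g
∑-mono-≤ []       f≤g = z≤n
∑-mono-≤ (x ∷ xs) f≤g = +-mono-≤ (f≤g x) (∑-mono-≤ xs f≤g)

∑-≡0 : (xs : List A) {f : A → ℕ} → (∀ x → f x ≡ 0) → ∑ xs f ≡ 0
∑-≡0 []       f≡0 = refl
∑-≡0 (x ∷ xs) f≡0 = cong₂ _+_ (f≡0 x) (∑-≡0 xs f≡0)

∑-+ : (xs : List A) (f g : A → ℕ) → ∑[ x ← xs ] (f x + g x) ≡ ∑ xs f + ∑ xs g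
∑-+ []       f g = refl
∑-+ (x ∷ xs) f g = trans (cong (f x + g x +_) (∑-+ xs f g)) (+-interchange (f x) (g x) _ _)
  where
  +-interchange : ∀ a b c d → a + b + (c + d) ≡ a + c + (b + d)
  +-interchange = solve-∀

∑-*ʳ : (xs : List A) (f : A → ℕ) (c : ℕ) → ∑[ x ← xs ] (f x * c) ≡ ∑ xs f * c
∑-*ʳ []       f c = refl
∑-*ʳ (x ∷ xs) f c = trans (cong (f x * c +_) (∑-*ʳ xs f c)) (sym (*-distribʳ-+ c (f x) _))

∑-map : (g : A → B) (xs : List A) (f : B → ℕ) → ∑ (map g xs) f ≡ ∑ xs (f ∘ g)
∑-map g xs f = cong sum (sym (map-∘ xs))

∑-concatMap : (g : A → List B) (xs : List A) (f : B → ℕ) →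
              ∑ (concatMap g xs) f ≡ ∑[ x ← xs ] ∑ (g x) f
∑-concatMap g []       f = refl
∑-concatMap g (x ∷ xs) f = begin
  sum (map f (g x ++ concatMap g xs))        ≡⟨ cong sum (map-++ f (g x) _) ⟩
  sum (map f (g x) ++ map f (concatMap g xs)) ≡⟨ sum-++ (map f (g x)) _ ⟩
  ∑ (g x) f + ∑ (concatMap g xs) f           ≡⟨ cong (∑ (g x) f +_) (∑-concatMap g xs f) ⟩
  ∑ (g x) f + ∑[ y ← xs ] ∑ (g y) f          ∎
  where open ≡-Reasoning

length-filterᵇ : (p : A → Bool) (xs : List A) → length (filterᵇ p xs) ≡ ∑[ x ← xs ] ind (p x)
length-filterᵇ p []       = refl
length-filterᵇ p (x ∷ xs) with p x
... | true  = cong suc (length-filterᵇ p xs)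
... | false = length-filterᵇ p xs

∑-≤-length-filterᵇ : (p : A → Bool) (xs : List A) {f : A → ℕ} (c : ℕ) →
                     (∀ x → p x ≡ false → f x ≡ 0) → (∀ x → p x ≡ true → f x ≤ c) →
                     ∑ xs f ≤ length (filterᵇ p xs) * c
∑-≤-length-filterᵇ p []       c vanish bound = z≤n
∑-≤-length-filterᵇ p (x ∷ xs) c vanish bound with p x in px
... | true  = +-mono-≤ (bound x px) (∑-≤-length-filterᵇ p xs c vanish bound)
... | false rewrite vanish x px = ∑-≤-length-filterᵇ p xs c vanish bound

∑-allFin-suc : (f : Fin (suc k) → ℕ) → ∑ (allFin (suc k)) f ≡ f zero + ∑[ i ← allFin k ] f (suc i)
∑-allFin-suc f = cong (λ xs → f zero + sum xs) (trans (map-tabulate suc f) (sym (map-tabulate id (f ∘ suc))))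

count-suc : (p : Fin (suc k) → Bool) → count p ≡ ind (p zero) + count (p ∘ suc)
count-suc p = ∑-allFin-suc (ind ∘ p)

count-mono-≤ : {p q : Fin k → Bool} → (∀ {i} → p i ≡ true → q i ≡ true) → count p ≤ count q
count-mono-≤ {k} {p} {q} p⇒q = ∑-mono-≤ (allFin k) ind-mono
  where
  ind-mono : ∀ i → ind (p i) ≤ ind (q i)
  ind-mono i with p i in pi
  ... | false = z≤n
  ... | true rewrite p⇒q pi = ≤-refl

count-none : {p : Fin k → Bool} → (∀ i → p i ≡ false) → count p ≡ 0
count-none {k} none = ∑-≡0 (allFin k) (cong ind ∘ none)

count-== : (c : Fin k) → count (_== c) ≡ 1
count-== {suc k} zero    = trans (count-suc {k} (_== zero)) (cong suc (count-none {k} (λ _ → refl)))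
count-== {suc k} (suc c) = trans (count-suc {k} (_== suc c)) (count-== c)

count-≤1 : {p : Fin k → Bool} → (∀ {i j} → p i ≡ true → p j ≡ true → i ≡ j) → count p ≤ 1
count-≤1 {zero}  unique = z≤n
count-≤1 {suc k} {p} unique rewrite count-suc p with p zero in p0
... | true  = ≤-reflexive (cong suc (count-none others))
  where
  others : ∀ i → p (suc i) ≡ false
  others i with p (suc i) in pi
  ... | true with () ← unique p0 pi
  ... | false = refl
... | false = count-≤1 (λ pi pj → suc-injective (unique pi pj))

all-allFin⇔ : (p : Fin k → Bool) → all p (allFin k) ≡ true ⇔ (∀ i → p i ≡ true)
all-allFin⇔ {k} p = mk⇔
  (λ all-p i → Equivalence.to T-≡ (All.lookup (all⁺ p (allFin k) (Equivalence.from T-≡ all-p)) (∈-allFin i)))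
  (λ p-all → Equivalence.to T-≡ (all⁻ p {xs = allFin k} (All.tabulate (λ {i} _ → Equivalence.from T-≡ (p-all i)))))

not-∨-⇔ : (b c : Bool) → not b ∨ c ≡ true ⇔ (b ≡ true → c ≡ true)
not-∨-⇔ true  c = mk⇔ (λ c≡true _ → c≡true) (λ b⇒c → b⇒c refl)
not-∨-⇔ false c = mk⇔ (λ _ ()) (λ _ → refl)

contraposeᵇ : {b c : Bool} → (b ≡ true → c ≡ true) → c ≡ false → b ≡ false
contraposeᵇ {false} b⇒c c≡false = refl
contraposeᵇ {true}  b⇒c c≡false = trans (sym (b⇒c refl)) c≡false

Preserves : (F G : Graph) → (Fin (size F) → Fin (size G)) → Set
Preserves F G f = ∀ {i j} → adj F i j ≡ true → adj G (f i) (f j) ≡ true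

isHom⇔Preserves : (F G : Graph) (f : Fin (size F) → Fin (size G)) → isHom F G f ≡ true ⇔ Preserves F G f
isHom⇔Preserves F G f = mk⇔
  (λ hom {i} {j} → Equivalence.to (not-∨-⇔ _ _) (Equivalence.to (all-allFin⇔ (edge i)) (Equivalence.to (all-allFin⇔ row) hom i) j))
  (λ pres → Equivalence.from (all-allFin⇔ row) λ i → Equivalence.from (all-allFin⇔ (edge i)) λ j →
              Equivalence.from (not-∨-⇔ _ _) pres)
  where
  edge : Fin (size F) → Fin (size F) → Bool
  edge i j = not (adj F i j) ∨ adj G (f i) (f j)
  row : Fin (size F) → Bool
  row i = all (edge i) (allFin (size F))

isHom-∘ : (F H G : Graph) {g : Fin (size F) → Fin (size H)} {f : Fin (size H) → Fin (size G)} →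
          Preserves F H g → isHom H G f ≡ true → isHom F G (f ∘ g) ≡ true
isHom-∘ F H G g-pres f-hom =
  Equivalence.from (isHom⇔Preserves F G _) (Equivalence.to (isHom⇔Preserves H G _) f-hom ∘ g-pres)

==-refl : (i : Fin k) → (i == i) ≡ true
==-refl i = dec-true (i ≟ i) refl

adj⇒≢ : (G : Graph) {x y : Fin (size G)} → adj G x y ≡ true → ¬ x ≡ y
adj⇒≢ G {x} xy refl with () ← trans (sym xy) (adj-irrefl G x)

commonNeighbours-≤1 : (G : Graph) → C4Free G → {b c : Fin (size G)} → ¬ b ≡ c →
                      count (λ a → adj G b a ∧ adj G c a) ≤ 1
commonNeighbours-≤1 G c4-free {b} {c} b≢c = count-≤1 unique
  where
  unique : ∀ {a a'} → adj G b a ∧ adj G c a ≡ true → adj G b a' ∧ adj G c a' ≡ true → a ≡ a'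
  unique {a} {a'} common common' = decidable-stable (a ≟ a') λ a≢a' → c4-free
    (b , a , c , a' , adj⇒≢ G ba , b≢c , adj⇒≢ G ba' , adj⇒≢ G ac , a≢a' , adj⇒≢ G ca' , ba , ac , ca' , a'b)
    where
    ba = ∧-conicalˡ _ _ common
    ba' = ∧-conicalˡ _ _ common'
    ac = trans (adj-sym G a c) (∧-conicalʳ _ _ common)
    ca' = ∧-conicalʳ _ _ common'
    a'b = trans (adj-sym G a' b) ba'

walks₃-≤ : (G : Graph) → C4Free G → {D : ℕ} → (∀ v → deg G v ≤ D) → (x y : Fin (size G)) →
           ∑[ b ← allFin (size G) ] count (λ a → adj G y b ∧ (adj G b a ∧ adj G x a)) ≤ D + D
walks₃-≤ G c4-free {D} deg≤D x y = begin
  ∑[ b ← allFin n ] count (walk b)                                  ≤⟨ ∑-mono-≤ (allFin n) walks-via ⟩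
  ∑[ b ← allFin n ] (ind (b == x) * D + ind (adj G y b))            ≡⟨ ∑-+ (allFin n) _ _ ⟩
  ∑[ b ← allFin n ] (ind (b == x) * D) + deg G y                    ≡⟨ cong (_+ deg G y) (∑-*ʳ (allFin n) _ D) ⟩
  count (_== x) * D + deg G y                                       ≡⟨ cong (λ m → m * D + deg G y) (count-== x) ⟩
  1 * D + deg G y                                                   ≤⟨ +-mono-≤ (≤-reflexive (*-identityˡ D)) (deg≤D y) ⟩
  D + D                                                             ∎
  where
  open ≤-Reasoning
  n = size G
  walk : Fin n → Fin n → Bool
  walk b a = adj G y b ∧ (adj G b a ∧ adj G x a)
  -- b = x leaves a free among the neighbours of x; otherwise a is a common neighbour of b ≠ x.
  walks-via : ∀ b → count (walk b) ≤ ind (b == x) * D + ind (adj G y b)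
  walks-via b with b ≟ x
  ... | yes refl = ≤-trans (count-mono-≤ {q = adj G b} (λ {a} → ∧-conicalˡ _ (adj G b a) ∘ ∧-conicalʳ (adj G y b) _))
                     (≤-trans (deg≤D b) (≤-trans (≤-reflexive (sym (*-identityˡ D))) (m≤m+n _ _)))
  ... | no b≢x with adj G y b
  ...   | true  = commonNeighbours-≤1 G c4-free b≢x
  ...   | false = ≤-reflexive (count-none {n} (λ _ → refl))

∑-allMaps-suc : (n : ℕ) (f : (Fin (suc k) → Fin n) → ℕ) →
                ∑ (allMaps (suc k) n) f ≡ ∑[ g ← allMaps k n ] ∑[ a ← allFin n ] f (cons a g)
∑-allMaps-suc {k} n f =
  trans (∑-concatMap _ (allMaps k n) f) (∑-cong (allMaps k n) λ g → ∑-map (λ a → cons a g) (allFin n) f)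

module _ (F G : Graph) {D : ℕ} (deg≤D : ∀ v → deg G v ≤ D) where

  private
    v = size F
    n = size G

  hom-addPendant-≤ : (u : Fin v) → hom (addPendant F u) G ≤ hom F G * D
  hom-addPendant-≤ u = begin
    hom F' G                                                  ≡⟨ length-filterᵇ (isHom F' G) (allMaps (suc v) n) ⟩
    ∑[ g ← allMaps (suc v) n ] ind (isHom F' G g)             ≡⟨ ∑-allMaps-suc n (ind ∘ isHom F' G) ⟩
    ∑[ f ← allMaps v n ] count (λ a → isHom F' G (cons a f))  ≤⟨ ∑-≤-length-filterᵇ (isHom F G) (allMaps v n) D vanish bound ⟩
    hom F G * D                                               ∎
    where
    open ≤-Reasoning
    F' = addPendant F u
    F⊆F' : Preserves F F' suc
    F⊆F' e = e
    vanish : ∀ f → isHom F G f ≡ false → count (λ a → isHom F' G (cons a f)) ≡ 0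
    vanish f f-not = count-none {n} λ a → contraposeᵇ (isHom-∘ F F' G F⊆F') f-not
    leaf : ∀ {f a} → isHom F' G (cons a f) ≡ true → adj G (f u) a ≡ true
    leaf ext = Equivalence.to (isHom⇔Preserves F' G _) ext {suc u} {zero} (==-refl u)
    bound : ∀ f → isHom F G f ≡ true → count (λ a → isHom F' G (cons a f)) ≤ D
    bound f _ = ≤-trans (count-mono-≤ {n} leaf) (deg≤D (f u))

  hom-addPath3-≤ : C4Free G → (u w : Fin v) → hom (addPath3 F u w) G ≤ hom F G * (D + D)
  hom-addPath3-≤ c4-free u w = begin
    hom F' G                                                           ≡⟨ length-filterᵇ (isHom F' G) (allMaps (suc (suc v)) n) ⟩
    ∑[ g ← allMaps (suc (suc v)) n ] ind (isHom F' G g)                ≡⟨ ∑-allMaps-suc n (ind ∘ isHom F' G) ⟩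
    ∑[ g ← allMaps (suc v) n ] count (λ a → isHom F' G (cons a g))     ≡⟨ ∑-allMaps-suc n (λ g → count (λ a → isHom F' G (cons a g))) ⟩
    ∑[ f ← allMaps v n ] ∑[ b ← allFin n ] count (extension f b)       ≤⟨ ∑-≤-length-filterᵇ (isHom F G) (allMaps v n) (D + D) vanish bound ⟩
    hom F G * (D + D)                                                  ∎
    where
    open ≤-Reasoning
    F' = addPath3 F u w
    F⊆F' : Preserves F F' (λ i → suc (suc i))
    F⊆F' e = e
    extension : (Fin v → Fin n) → Fin n → Fin n → Bool
    extension f b a = isHom F' G (cons a (cons b f))
    vanish : ∀ f → isHom F G f ≡ false → ∑[ b ← allFin n ] count (extension f b) ≡ 0
    vanish f f-not = ∑-≡0 (allFin n) λ b → count-none {n} λ a → contraposeᵇ (isHom-∘ F F' G F⊆F') f-not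
    walk : ∀ {f b a} → extension f b a ≡ true → adj G (f w) b ∧ (adj G b a ∧ adj G (f u) a) ≡ true
    walk ext = cong₂ _∧_ (pres {suc (suc w)} {suc zero} (==-refl w))
                         (cong₂ _∧_ (pres {suc zero} {zero} refl) (pres {suc (suc u)} {zero} (==-refl u)))
      where pres = Equivalence.to (isHom⇔Preserves F' G _) ext
    bound : ∀ f → isHom F G f ≡ true → ∑[ b ← allFin n ] count (extension f b) ≤ D + D
    bound f _ = ≤-trans (∑-mono-≤ (allFin n) λ b → count-mono-≤ {n} walk) (walks₃-≤ G c4-free deg≤D (f u) (f w))

edgeCount : {m : ℕ} → (Fin m → Fin m → Bool) → ℕ
edgeCount {m} a = ∑[ i ← allFin m ] count (λ j → does (toℕ i <? toℕ j) ∧ a i j)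

edgeCount-suc : {m : ℕ} (a : Fin (suc m) → Fin (suc m) → Bool) →
                edgeCount a ≡ count (a zero ∘ suc) + edgeCount (λ i j → a (suc i) (suc j))
edgeCount-suc {m} a = trans (∑-allFin-suc (λ i → count (λ j → does (toℕ i <? toℕ j) ∧ a i j)))
  (cong₂ _+_ (count-suc (λ j → does (0 <? toℕ j) ∧ a zero j))
             (∑-cong (allFin m) λ i → count-suc (λ j → does (suc (toℕ i) <? toℕ j) ∧ a (suc i) j)))

edges-addPendant : (F : Graph) (u : Fin (size F)) → edges (addPendant F u) ≡ suc (edges F)
edges-addPendant F u = trans (edgeCount-suc (pendAdj F u)) (cong (_+ edges F) (count-== u))

edges-addPath3 : (F : Graph) (u w : Fin (size F)) → edges (addPath3 F u w) ≡ 3 + edges F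
edges-addPath3 F u w = begin
  edges (addPath3 F u w)                                         ≡⟨ edgeCount-suc (pathAdj F u w) ⟩
  count (pathAdj F u w zero ∘ suc) + edgeCount inner             ≡⟨ cong₂ _+_ (count-suc (pathAdj F u w zero ∘ suc)) (edgeCount-suc inner) ⟩
  suc (count (_== u)) + (count (_== w) + edges F)                ≡⟨ cong₂ (λ x y → suc x + (y + edges F)) (count-== u) (count-== w) ⟩
  3 + edges F                                                    ∎
  where
  open ≡-Reasoning
  inner : Fin (suc (size F)) → Fin (suc (size F)) → Bool
  inner i j = pathAdj F u w (suc i) (suc j)

∃-bound-of-squares : (h : Fin k → ℕ) {N : ℕ} → (∀ i → h i * h i ≤ N) → ∃[ D ] (∀ i → h i ≤ D) × D * D ≤ N
∃-bound-of-squares {zero}  h sq = 0 , (λ ()) , z≤n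
∃-bound-of-squares {suc k} h sq with ∃-bound-of-squares (h ∘ suc) (sq ∘ suc)
... | D , h≤D , D² with ≤-total (h zero) D
...   | inj₁ h₀≤D = D , (λ { zero → h₀≤D ; (suc i) → h≤D i }) , D²
...   | inj₂ D≤h₀ = h zero , (λ { zero → ≤-refl ; (suc i) → ≤-trans (h≤D i) D≤h₀ }) , sq zero

tame-extension : (F F' : Graph) (a m : ℕ) →
                 size F' ≡ suc a + size F → edges F' ≡ suc (2 * a) + edges F →
                 (∀ G → C4Free G → {D : ℕ} → (∀ v → deg G v ≤ D) → hom F' G ≤ hom F G * (m * D)) →
                 Tame F → Tame F'
tame-extension F F' a m size≡ edges≡ hom≤ (C , tame-F) = 2 * m * C , bound
  where
  bound : ∀ G → C4Free G → MaxDeg≤2√n G →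
          hom F' G * hom F' G * size G ^ edges F' ≤ 2 * m * C * (2 * m * C) * size G ^ (2 * size F')
  bound G c4-free maxdeg with ∃-bound-of-squares (deg G) maxdeg
  ... | D , deg≤D , D² = begin
    h' * h' * n ^ edges F'                          ≡⟨ cong (λ e → h' * h' * n ^ e) edges≡ ⟩
    h' * h' * n ^ (suc (2 * a) + edges F)           ≡⟨ cong (λ x → h' * h' * (n * x)) (^-distribˡ-+-* n (2 * a) (edges F)) ⟩
    h' * h' * (n * (P * E))                         ≤⟨ *-monoˡ-≤ (n * (P * E)) (*-mono-≤ h'≤ h'≤) ⟩
    h * (m * D) * (h * (m * D)) * (n * (P * E))     ≡⟨ regroup h m D n P E ⟩
    D * D * (m * m * (n * P) * (h * h * E))         ≤⟨ *-mono-≤ D² (*-monoʳ-≤ (m * m * (n * P)) (tame-F G c4-free maxdeg)) ⟩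
    4 * n * (m * m * (n * P) * (C * C * V))         ≡⟨ collect C m n P V ⟩
    2 * m * C * (2 * m * C) * (n * (n * (P * V)))   ≡⟨ cong (2 * m * C * (2 * m * C) *_) (sym n^[2|V'|]) ⟩
    2 * m * C * (2 * m * C) * n ^ (2 * size F')     ∎
    where
    open ≤-Reasoning
    n = size G
    h = hom F G
    h' = hom F' G
    P = n ^ (2 * a)
    E = n ^ edges F
    V = n ^ (2 * size F)
    h'≤ : h' ≤ h * (m * D)
    h'≤ = hom≤ G c4-free deg≤D
    regroup : ∀ h m D n P E → h * (m * D) * (h * (m * D)) * (n * (P * E)) ≡ D * D * (m * m * (n * P) * (h * h * E))
    regroup = solve-∀
    collect : ∀ C m n P V → 4 * n * (m * m * (n * P) * (C * C * V)) ≡ 2 * m * C * (2 * m * C) * (n * (n * (P * V)))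
    collect = solve-∀
    double : ∀ a v → 2 * (suc a + v) ≡ suc (suc (2 * a + 2 * v))
    double = solve-∀
    n^[2|V'|] : n ^ (2 * size F') ≡ n * (n * (P * V))
    n^[2|V'|] = begin-equality
      n ^ (2 * size F')                     ≡⟨ cong (λ s → n ^ (2 * s)) size≡ ⟩
      n ^ (2 * (suc a + size F))            ≡⟨ cong (n ^_) (double a (size F)) ⟩
      n * (n * n ^ (2 * a + 2 * size F))    ≡⟨ cong (λ x → n * (n * x)) (^-distribˡ-+-* n (2 * a) (2 * size F)) ⟩
      n * (n * (P * V))                     ∎

proposition2p4 : (F : Graph) → Tame F →
                 ((u : Fin (size F)) → Tame (addPendant F u)) ×
                 ((u w : Fin (size F)) → Tame (addPath3 F u w))
proposition2p4 F tame-F = pendant , path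
  where
  pendant : (u : Fin (size F)) → Tame (addPendant F u)
  pendant u = tame-extension F (addPendant F u) 0 1 refl (edges-addPendant F u) hom≤ tame-F
    where
    hom≤ : ∀ G → C4Free G → {D : ℕ} → (∀ v → deg G v ≤ D) → hom (addPendant F u) G ≤ hom F G * (1 * D)
    hom≤ G _ {D} deg≤D = subst (λ d → _ ≤ hom F G * d) (sym (*-identityˡ D)) (hom-addPendant-≤ F G deg≤D u)
  path : (u w : Fin (size F)) → Tame (addPath3 F u w)
  path u w = tame-extension F (addPath3 F u w) 1 2 refl (edges-addPath3 F u w) hom≤ tame-F
    where
    hom≤ : ∀ G → C4Free G → {D : ℕ} → (∀ v → deg G v ≤ D) → hom (addPath3 F u w) G ≤ hom F G * (2 * D)
    hom≤ G c4-free {D} deg≤D =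
      subst (λ d → _ ≤ hom F G * (D + d)) (sym (+-identityʳ D)) (hom-addPath3-≤ F G deg≤D c4-free u w)
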